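{- For $r\ge 4$ and $s,t\ge 2$, $R^r(\partial K_t,\partial K_s)=\max\{s,t,r\}$.
   Context: The 2-shadow $\partial_2(\mathcal{H})$ of a hypergraph $\mathcal{H}$ is the graph on $V(\mathcal{H})$ whose edges are the pairs $\{x,y\}$ contained in some hyperedge of $\mathcal{H}$. For a graph $G$, $\partial G$ is the set of $r$-uniform hypergraphs whose 2-shadow contains $G$ as a subgraph (up to isomorphism). $K_n$ is the complete graph on $n$ vertices. For collections $\mathcal{F}_1,\mathcal{F}_2$ of $r$-uniform hypergraphs, $R^r(\mathcal{F}_1,\mathcal{F}_2)$ is the least $N$ such that every 2-coloring of the hyperedges of the complete $r$-uniform hypergraph on $N$ vertices contains a subhypergraph of the first color isomorphic to a member of $\mathcal{F}_1$ or one of the second color isomorphic to a member of $\mathcal{F}_2$. -}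

module Defs where

open import Level using (Level; 0ℓ) renaming (suc to lsuc)
open import Data.Nat using (ℕ; _<_; _≤_)
open import Data.Bool using (Bool; true; false)
open import Data.Fin using (Fin)
open import Data.Fin.Subset using (Subset; _∈_; ∣_∣)
open import Data.Product using (Σ; ∃; _×_)
open import Data.Sum using (_⊎_)
open import Function.Definitions using (Injective)
open import Relation.Binary.PropositionalEquality using (_≡_; _≢_)
open import Relation.Nullary using (¬_)

Hypergraph : ℕ → Set₁
Hypergraph N = Subset N → Set

Graph : ℕ → Set₁
Graph N = Fin N → Fin N → Set

Uniform : ∀ {N} → ℕ → Hypergraph N → Set
Uniform r H = ∀ S → H S → ∣ S ∣ ≡ r

_⊆ₕ_ : ∀ {N} → Hypergraph N → Hypergraph N → Set
H ⊆ₕ H' = ∀ S → H S → H' S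

Shadow2 : ∀ {N} → Hypergraph N → Graph N
Shadow2 H x y = x ≢ y × Σ (Subset _) (λ S → H S × x ∈ S × y ∈ S)

ContainsK : ∀ {N} → ℕ → Graph N → Set
ContainsK {N} n G =
  Σ (Fin n → Fin N) λ f → Injective _≡_ _≡_ f × (∀ i j → i ≢ j → G (f i) (f j))

-- H belongs to ∂K_n (as r-uniform hypergraphs): H is r-uniform and its
-- 2-shadow contains K_n.
In∂K : ∀ {N} → ℕ → ℕ → Hypergraph N → Set
In∂K r n H = Uniform r H × ContainsK n (Shadow2 H)

-- A 2-colouring of the hyperedges of the complete r-uniform hypergraph
-- on Fin N (values on non-r-subsets are irrelevant).
Colouring : ℕ → Set
Colouring N = Subset N → Bool

ColourClass : ∀ {N} → ℕ → Colouring N → Bool → Hypergraph N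
ColourClass r c b S = ∣ S ∣ ≡ r × c S ≡ b

HasMono∂K : ∀ {N} → ℕ → Colouring N → Bool → ℕ → Set₁
HasMono∂K {N} r c b n =
  Σ (Hypergraph N) λ H → H ⊆ₕ ColourClass r c b × In∂K r n H

Arrows : ℕ → ℕ → ℕ → ℕ → Set₁
Arrows r t s N = (c : Colouring N) → HasMono∂K r c true t ⊎ HasMono∂K r c false s

RamseyNumber∂K : ℕ → ℕ → ℕ → ℕ → Set₁
RamseyNumber∂K r t s N = Arrows r t s N × (∀ M → M < N → ¬ Arrows r t s M)

-- If some pair of vertices lies in no r-set of the first colour then, since r ≥ 4, it
-- extends together with any other pair to an r-set, which must have the second colour.
-- So one of the two colour classes covers every pair, and its shadow is complete on all
-- N vertices. Conversely a colour class with a copy of ∂K_n needs n vertices and, for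
-- n ≥ 2, an r-set; constant colourings then force N ≥ s, N ≥ t and N ≥ r.
module Submission where

open import Defs
open import Data.Nat using (ℕ; _≤_; _⊔_)

open import Data.Nat using (zero; suc; _+_; z≤n; s≤s; _≤?_; _≟_)
open import Data.Nat.Properties
  using (≤-trans; ≤-reflexive; ≤-antisym; ≰⇒>; n≤1+n; +-suc; +-monoˡ-≤; +-monoʳ-≤;
         ⊔-lub; m≤m⊔n; m≤n⊔m; <⇒≱; module ≤-Reasoning)
open import Data.Bool using (true; false; not)
open import Data.Bool.Properties using (¬-not) renaming (_≟_ to _≟ᵇ_)
open import Data.Fin using (Fin; inject≤) renaming (zero to fzero; suc to fsuc)
open import Data.Fin.Properties using (any?; inject≤-injective; injective⇒≤)
open import Data.Fin.Subset using (Subset; _∪_; ⁅_⁆; _⊆_; ⊤; _∈_; ∣_∣; inside; outside)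
open import Data.Fin.Subset.Properties
  using (∣p∣≤n; ∣⊤∣≡n; ∣⁅x⁆∣≡1; ⊆⊤; x∈⁅x⁆; p⊆p∪q; q⊆p∪q; in⊆in; out⊆; anySubset?; _∈?_)
open import Data.Vec using ([]; _∷_)
open import Data.Product using (Σ; ∃; _×_; _,_; proj₁)
open import Data.Sum using (inj₁; inj₂)
open import Function using (_∘_)
open import Relation.Nullary using (¬_; Dec; yes; no; ¬?)
open import Relation.Nullary.Decidable using (_×-dec_; decidable-stable)
open import Relation.Binary.PropositionalEquality using (_≡_; refl; sym; trans; cong; subst)

∣p∪q∣≤∣p∣+∣q∣ : ∀ {n} (p q : Subset n) → ∣ p ∪ q ∣ ≤ ∣ p ∣ + ∣ q ∣
∣p∪q∣≤∣p∣+∣q∣ []            []            = z≤n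
∣p∪q∣≤∣p∣+∣q∣ (inside ∷ p)  (inside ∷ q)  =
  s≤s (≤-trans (∣p∪q∣≤∣p∣+∣q∣ p q) (+-monoʳ-≤ ∣ p ∣ (n≤1+n ∣ q ∣)))
∣p∪q∣≤∣p∣+∣q∣ (inside ∷ p)  (outside ∷ q) = s≤s (∣p∪q∣≤∣p∣+∣q∣ p q)
∣p∪q∣≤∣p∣+∣q∣ (outside ∷ p) (inside ∷ q)  =
  ≤-trans (s≤s (∣p∪q∣≤∣p∣+∣q∣ p q)) (≤-reflexive (sym (+-suc ∣ p ∣ ∣ q ∣)))
∣p∪q∣≤∣p∣+∣q∣ (outside ∷ p) (outside ∷ q) = ∣p∪q∣≤∣p∣+∣q∣ p q

superset-of-size : ∀ {n} (p : Subset n) {k} → ∣ p ∣ ≤ k → k ≤ n →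
                   ∃ λ q → p ⊆ q × ∣ q ∣ ≡ k
superset-of-size []            {zero}  _         _         = [] , (λ x∈p → x∈p) , refl
superset-of-size (inside ∷ p)  {suc k} (s≤s p≤k) (s≤s k≤n) with superset-of-size p p≤k k≤n
... | q , p⊆q , ∣q∣≡k = inside ∷ q , in⊆in p⊆q , cong suc ∣q∣≡k
superset-of-size {suc n} (outside ∷ p) {k} p≤k k≤1+n with k ≤? n
... | yes k≤n with superset-of-size p p≤k k≤n
...   | q , p⊆q , ∣q∣≡k = outside ∷ q , out⊆ p⊆q , ∣q∣≡k
superset-of-size {suc n} (outside ∷ p) {k} p≤k k≤1+n | no k≰n =
  ⊤ , ⊆⊤ , trans (cong suc (∣⊤∣≡n n)) (≤-antisym (≰⇒> k≰n) k≤1+n)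

∣p∪⁅x⁆∣≤∣p∣+1 : ∀ {n} (p : Subset n) x → ∣ p ∪ ⁅ x ⁆ ∣ ≤ ∣ p ∣ + 1
∣p∪⁅x⁆∣≤∣p∣+1 p x = ≤-trans (∣p∪q∣≤∣p∣+∣q∣ p ⁅ x ⁆) (≤-reflexive (cong (∣ p ∣ +_) (∣⁅x⁆∣≡1 x)))

r-set-through-four-points : ∀ {N r} → 4 ≤ r → r ≤ N → (w x y z : Fin N) →
  ∃ λ S → ∣ S ∣ ≡ r × w ∈ S × x ∈ S × y ∈ S × z ∈ S
r-set-through-four-points 4≤r r≤N w x y z
  with superset-of-size U (≤-trans ∣U∣≤4 4≤r) r≤N
  where
  U = ((⁅ w ⁆ ∪ ⁅ x ⁆) ∪ ⁅ y ⁆) ∪ ⁅ z ⁆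
  ∣U∣≤4 : ∣ U ∣ ≤ 4
  ∣U∣≤4 = begin
    ∣ U ∣                                   ≤⟨ ∣p∪⁅x⁆∣≤∣p∣+1 ((⁅ w ⁆ ∪ ⁅ x ⁆) ∪ ⁅ y ⁆) z ⟩
    ∣ (⁅ w ⁆ ∪ ⁅ x ⁆) ∪ ⁅ y ⁆ ∣ + 1         ≤⟨ +-monoˡ-≤ 1 (∣p∪⁅x⁆∣≤∣p∣+1 (⁅ w ⁆ ∪ ⁅ x ⁆) y) ⟩
    ∣ ⁅ w ⁆ ∪ ⁅ x ⁆ ∣ + 1 + 1               ≤⟨ +-monoˡ-≤ 1 (+-monoˡ-≤ 1 (∣p∪⁅x⁆∣≤∣p∣+1 ⁅ w ⁆ x)) ⟩
    ∣ ⁅ w ⁆ ∣ + 1 + 1 + 1                   ≡⟨ cong (λ m → m + 1 + 1 + 1) (∣⁅x⁆∣≡1 w) ⟩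
    4                                       ∎
    where open ≤-Reasoning
... | S , U⊆S , ∣S∣≡r =
  S , ∣S∣≡r ,
  U⊆S (p⊆p∪q _ (p⊆p∪q _ (p⊆p∪q _ (x∈⁅x⁆ w)))) ,
  U⊆S (p⊆p∪q _ (p⊆p∪q _ (q⊆p∪q _ _ (x∈⁅x⁆ x)))) ,
  U⊆S (p⊆p∪q _ (q⊆p∪q _ _ (x∈⁅x⁆ y))) ,
  U⊆S (q⊆p∪q _ _ (x∈⁅x⁆ z))

Covers : ∀ {N} → Hypergraph N → Fin N → Fin N → Set
Covers {N} H x y = Σ (Subset N) λ S → H S × x ∈ S × y ∈ S

PairCovering : ∀ {N} → Hypergraph N → Set
PairCovering H = ∀ x y → Covers H x y

PairCovering⇒ContainsK : ∀ {N n} {H : Hypergraph N} → n ≤ N → PairCovering H →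
                         ContainsK n (Shadow2 H)
PairCovering⇒ContainsK n≤N cover =
  embed , embed-injective , λ i j i≢j → i≢j ∘ embed-injective , cover (embed i) (embed j)
  where
  embed : Fin _ → Fin _
  embed i = inject≤ i n≤N
  embed-injective : ∀ {i j} → embed i ≡ embed j → i ≡ j
  embed-injective {i} {j} = inject≤-injective n≤N n≤N i j

PairCovering⇒HasMono∂K : ∀ {N n r} {c : Colouring N} {b} → n ≤ N →
                         PairCovering (ColourClass r c b) → HasMono∂K r c b n
PairCovering⇒HasMono∂K n≤N cover =
  ColourClass _ _ _ , (λ S h → h) , (λ S → proj₁) , PairCovering⇒ContainsK n≤N cover

covers? : ∀ {N} r (c : Colouring N) b x y → Dec (Covers (ColourClass r c b) x y)
covers? r c b x y =
  anySubset? λ S → (∣ S ∣ ≟ r ×-dec c S ≟ᵇ b) ×-dec x ∈? S ×-dec y ∈? S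

¬Covers⇒PairCovering-not : ∀ {N r} {c : Colouring N} {b x y} → 4 ≤ r → r ≤ N →
  ¬ Covers (ColourClass r c b) x y → PairCovering (ColourClass r c (not b))
¬Covers⇒PairCovering-not {x = x} {y} 4≤r r≤N uncovered u v
  with r-set-through-four-points 4≤r r≤N x y u v
... | S , ∣S∣≡r , x∈S , y∈S , u∈S , v∈S =
  S , (∣S∣≡r , ¬-not λ cS≡b → uncovered (S , (∣S∣≡r , cS≡b) , x∈S , y∈S)) , u∈S , v∈S

arrows : ∀ {r s t N} → 4 ≤ r → r ≤ N → s ≤ N → t ≤ N → Arrows r t s N
arrows {r} 4≤r r≤N s≤N t≤N c with any? (λ x → any? λ y → ¬? (covers? r c true x y))
... | yes (x , y , uncovered) =
  inj₂ (PairCovering⇒HasMono∂K s≤N (¬Covers⇒PairCovering-not 4≤r r≤N uncovered))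
... | no ¬uncovered =
  inj₁ (PairCovering⇒HasMono∂K t≤N λ x y →
    decidable-stable (covers? r c true x y) λ ¬covered → ¬uncovered (x , y , ¬covered))

HasMono∂K⇒≤ : ∀ {N r n} {c : Colouring N} {b} → HasMono∂K r c b n → n ≤ N
HasMono∂K⇒≤ (_ , _ , _ , _ , injective , _) = injective⇒≤ injective

HasMono∂K⇒edge : ∀ {N r n} {c : Colouring N} {b} → 2 ≤ n → HasMono∂K r c b n →
                 ∃ (ColourClass r c b)
HasMono∂K⇒edge {n = suc (suc _)} _ (_ , H⊆class , _ , _ , _ , adjacent)
  with adjacent fzero (fsuc fzero) (λ ())
... | _ , S , S∈H , _ = S , H⊆class S S∈H
HasMono∂K⇒edge {n = suc zero} (s≤s ()) _

HasMono∂K⇒r≤N : ∀ {N r n} {c : Colouring N} {b} → 2 ≤ n → HasMono∂K r c b n → r ≤ N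
HasMono∂K⇒r≤N 2≤n copy with HasMono∂K⇒edge 2≤n copy
... | S , ∣S∣≡r , _ = subst (_≤ _) ∣S∣≡r (∣p∣≤n S)

Arrows⇒s≤N : ∀ {r s t N} → 2 ≤ t → Arrows r t s N → s ≤ N
Arrows⇒s≤N 2≤t arrow with arrow (λ _ → false)
... | inj₂ false-copy = HasMono∂K⇒≤ false-copy
... | inj₁ true-copy with HasMono∂K⇒edge 2≤t true-copy
...   | _ , _ , ()

Arrows⇒t≤N : ∀ {r s t N} → 2 ≤ s → Arrows r t s N → t ≤ N
Arrows⇒t≤N 2≤s arrow with arrow (λ _ → true)
... | inj₁ true-copy = HasMono∂K⇒≤ true-copy
... | inj₂ false-copy with HasMono∂K⇒edge 2≤s false-copy
...   | _ , _ , ()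

Arrows⇒r≤N : ∀ {r s t N} → 2 ≤ s → 2 ≤ t → Arrows r t s N → r ≤ N
Arrows⇒r≤N 2≤s 2≤t arrow with arrow (λ _ → true)
... | inj₁ true-copy  = HasMono∂K⇒r≤N 2≤t true-copy
... | inj₂ false-copy = HasMono∂K⇒r≤N 2≤s false-copy

proposition3p2 : ∀ (r s t : ℕ) → 4 ≤ r → 2 ≤ s → 2 ≤ t →
    RamseyNumber∂K r t s (s ⊔ (t ⊔ r))
proposition3p2 r s t 4≤r 2≤s 2≤t =
  arrows 4≤r r≤N s≤N t≤N ,
  λ M M<N arrow → <⇒≱ M<N (⊔-lub (Arrows⇒s≤N 2≤t arrow)
                            (⊔-lub (Arrows⇒t≤N 2≤s arrow) (Arrows⇒r≤N 2≤s 2≤t arrow)))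
  where
  s≤N : s ≤ s ⊔ (t ⊔ r)
  s≤N = m≤m⊔n s (t ⊔ r)
  t≤N : t ≤ s ⊔ (t ⊔ r)
  t≤N = ≤-trans (m≤m⊔n t r) (m≤n⊔m s (t ⊔ r))
  r≤N : r ≤ s ⊔ (t ⊔ r)
  r≤N = ≤-trans (m≤n⊔m t r) (m≤n⊔m s (t ⊔ r))
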